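{- Fix $n\in\mathbb N$ and let $H_0$ be a weakly $n$-saturated finite graph with vertex set $V(H_0)=\{1,2,\dots,k\}$ for some $k\geq n$. For $m\in\mathbb N$ let $H_m$ be the random graph with vertex set $\{1,\dots,k\}\times\{0,1,\dots,m\}$ whose edge relation is defined by: (i) for every $i<j\leq k$, $(i,0)$ and $(j,0)$ are adjacent in $H_m$ if and only if $i$ and $j$ are adjacent in $H_0$; (ii) for any $i,j\leq k$, if $i$ and $j$ are not adjacent in $H_0$, then $(i,s)$ and $(j,t)$ are not adjacent for any $s,t\leq m$; (iii) if $i$ and $j$ are adjacent in $H_0$ and $s,t\leq m$ with at least one of $s,t$ greater than $0$, then $(i,s)$ and $(j,t)$ are adjacent with probability $1/2$, each such decision being made independently of all others; (iv) $H_m$ is reflexive. Then there is $m\in\mathbb N$ such that (A) the probability that $H_m$ is $n$-saturated is positive; and (B) the probability of the following event $\mathcal X$ is positive: for every $p<n$, every $i_1,\dots,i_p,i\in V(H_0)$ such that $i_1,\dots,i_p$ are adjacent to $i$ in $H_0$, and every $j_1,\dots,j_p\in\{0,1,\dots,m\}$, there is $l\in\{0,1,\dots,m\}$ such that $(i_1,j_1),\dots,(i_p,j_p)$ are all adjacent to $(i,l)$ in $H_m$.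
   Context: A graph is a pair $G=(V(G),E(G))$ with $V(G)$ non-empty and $E(G)$ a symmetric reflexive relation on $V(G)$. $G$ is weakly $n$-saturated if for every $A\subseteq V(G)$ with $|A|<n$ there is $x\in V(G)$ adjacent to every $a\in A$. For $A\subseteq V(G)$, a type over $A$ is a function $f\colon A\to\{0,1\}$; a vertex $v\in V(G)\setminus A$ realizes $f$ if for every $a\in A$, $(a,v)\in E(G)$ iff $f(a)=1$. $G$ is $n$-saturated if for every $A\subseteq V(G)$ with $|A|<n$ and every type $f$ over $A$ there is a vertex realizing $f$. -}

module Defs where

open import Data.Nat using (ℕ; zero; suc; _<_; _≤_)
open import Data.Fin using (Fin) renaming (zero to fzero)
open import Data.Bool using (Bool; true)
open import Data.List using (List; length; lookup)
open import Data.List.Membership.Propositional using (_∈_; _∉_)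
open import Data.List.Relation.Unary.Unique.Propositional using (Unique)
open import Data.Product using (Σ; ∃; _×_; _,_)
open import Data.Sum using (_⊎_)
open import Function.Bundles using (_⇔_)
open import Relation.Binary.PropositionalEquality using (_≡_; _≢_; refl)

record Graph (V : Set) : Set₁ where
  field
    E      : V → V → Set
    E-sym  : ∀ {x y} → E x y → E y x
    E-refl : ∀ x → E x x
open Graph public

-- Finite subsets A ⊆ V are represented by duplicate-free lists.
-- Weakly n-saturated: every A with |A| < n has a common neighbour.
WeaklySaturated : ℕ → {V : Set} → Graph V → Set
WeaklySaturated n {V} G =
  (A : List V) → Unique A → length A < n →
  ∃ λ x → ∀ a → a ∈ A → E G a x

-- A type over A (a duplicate-free list) is f : A → {0,1}, indexed by the
-- positions of A; v realizes f if v ∉ A and (a_i , v) ∈ E ⇔ f i = 1.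
Realizes : {V : Set} → Graph V → (A : List V) → (Fin (length A) → Bool) → V → Set
Realizes G A f v = v ∉ A × (∀ i → E G (lookup A i) v ⇔ (f i ≡ true))

Saturated : ℕ → {V : Set} → Graph V → Set
Saturated n {V} G =
  (A : List V) → Unique A → length A < n →
  (f : Fin (length A) → Bool) → ∃ λ v → Realizes G A f v

-- An outcome of the independent fair coin flips: a symmetric 0/1 choice
-- for every (unordered) pair of vertices of {1..k}×{0..m}. Since the
-- probability space is finite and uniform (each outcome has probability
-- 2^{-N} > 0), an event has positive probability iff some outcome lies in it.
Coins : ℕ → ℕ → Set
Coins k m = Σ (Fin k × Fin (suc m) → Fin k × Fin (suc m) → Bool)
              λ c → ∀ x y → c x y ≡ c y x

HmE : {k : ℕ} → (H0 : Graph (Fin k)) → (m : ℕ) → Coins k m →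
      Fin k × Fin (suc m) → Fin k × Fin (suc m) → Set
HmE H0 m (c , _) (i , s) (j , t) =
  ((i , s) ≡ (j , t))
  ⊎ ((s ≡ fzero × t ≡ fzero) × E H0 i j)
  ⊎ (E H0 i j × (s ≢ fzero ⊎ t ≢ fzero) × c (i , s) (j , t) ≡ true)

private
  sym≡ : ∀ {A : Set} {x y : A} → x ≡ y → y ≡ x
  sym≡ refl = refl

  or-sym : ∀ {A B : Set} → A ⊎ B → B ⊎ A
  or-sym (_⊎_.inj₁ a) = _⊎_.inj₂ a
  or-sym (_⊎_.inj₂ b) = _⊎_.inj₁ b

HmE-sym : {k : ℕ} (H0 : Graph (Fin k)) (m : ℕ) (cs : Coins k m) →
          ∀ {x y} → HmE H0 m cs x y → HmE H0 m cs y x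
HmE-sym H0 m cs (_⊎_.inj₁ eq) = _⊎_.inj₁ (sym≡ eq)
HmE-sym H0 m cs (_⊎_.inj₂ (_⊎_.inj₁ ((s0 , t0) , e))) =
  _⊎_.inj₂ (_⊎_.inj₁ ((t0 , s0) , E-sym H0 e))
HmE-sym H0 m (c , csym) {x} {y} (_⊎_.inj₂ (_⊎_.inj₂ (e , nz , ce))) =
  _⊎_.inj₂ (_⊎_.inj₂ (E-sym H0 e , or-sym nz , trans' (csym y x) ce))
  where
  trans' : ∀ {A : Set} {a b d : A} → a ≡ b → b ≡ d → a ≡ d
  trans' refl q = q

Hm : {k : ℕ} → Graph (Fin k) → (m : ℕ) → Coins k m → Graph (Fin k × Fin (suc m))
Hm H0 m cs = record
  { E = HmE H0 m cs
  ; E-sym = HmE-sym H0 m cs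
  ; E-refl = λ x → _⊎_.inj₁ refl
  }

EventX : ℕ → {k : ℕ} → Graph (Fin k) → (m : ℕ) → Coins k m → Set
EventX n {k} H0 m cs =
  (p : ℕ) → p < n → (is : Fin p → Fin k) → (i : Fin k) →
  (∀ r → E H0 (is r) i) → (js : Fin p → Fin (suc m)) →
  ∃ λ (l : Fin (suc m)) → ∀ r → E (Hm H0 m cs) (is r , js r) (i , l)

-- Encode an outcome of the coins by one table of fair bits per level l ≤ m, indexed by the
-- vertices, and let the coin between x and y be the xor of the entry at y in the table of x's
-- level and the entry at x in the table of y's level. To realise a type f over A, take a
-- common H₀-neighbour i of the rows of A (weak saturation) and look for a level l ≠ 0 not used
-- by A at which (i , l) has the prescribed coins to A. Given the tables of the levels used by
-- A, this prescribes |A| distinct entries of the table of level l, so each free level fails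
-- with probability 1 - 2^-|A|, independently of the others, and all of them fail with
-- probability at most 2^-s once there are 2^|A|·s free levels. A union bound over the
-- polynomially many requests (A , f , i) leaves an outcome in which no request fails. Event 𝒳
-- holds for the outcome with all coins 1, taking l = 0.
module Submission where

open import Defs
open import Algebra.Properties.CommutativeSemigroup as CommSemigroup using ()
open import Data.Bool using (Bool; true; false; not; _∧_; _∨_; _xor_)
open import Data.Bool.Properties using (xor-comm; xor-identityʳ; not-involutive) renaming (_≟_ to _≟ᵇ_)
open import Data.Fin using (Fin; zero; suc; combine; _≟_)
open import Data.Fin.Properties using (all?; ¬∀⟶∃¬; combine-injective)
open import Data.List using (List; []; _∷_; _++_; map; length; allFin; tabulate; deduplicate;
                             cartesianProductWith; cartesianProduct)
import Data.List as List
open import Data.List.Properties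
  using (map-tabulate; map-∘; map-cong-local; length-map; length-tabulate; tabulate-lookup; length-deduplicate)
open import Data.List.Membership.Propositional using (_∈_; _∉_)
open import Data.List.Membership.Propositional.Properties
  using (∈-map⁺; ∈-allFin; ∈-lookup; ∈-tabulate⁺; ∈-deduplicate⁺; ∈-cartesianProductWith⁺;
         ∈-cartesianProductWith⁻; ∈-cartesianProduct⁺; ∈-cartesianProduct⁻)
open import Data.List.Relation.Unary.All as All using (All; []; _∷_)
open import Data.List.Relation.Unary.All.Properties using (map⁻)
open import Data.List.Relation.Unary.AllPairs using (_∷_)
open import Data.List.Relation.Unary.Any using (here; there)
open import Data.List.Relation.Unary.Unique.Propositional using (Unique)
open import Data.List.Relation.Unary.Unique.Propositional.Properties using () renaming (map⁺ to Unique-map⁺)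
open import Data.List.Relation.Unary.Unique.DecPropositional.Properties using (deduplicate-!)
open import Data.Nat using (ℕ; zero; suc; pred; _+_; _*_; _∸_; _^_; _≤_; _<_; z≤n; s≤s; NonZero; >-nonZero)
open import Data.Nat.Properties hiding (_≟_)
open import Data.Nat.Solver using (module +-*-Solver)
open import Data.Product as Σ using (∃; _×_; _,_; proj₁; proj₂)
open import Data.Product.Properties using (≡-dec)
open import Data.Sum as Sum using (_⊎_; inj₁; inj₂)
open import Data.Vec using (Vec; []; _∷_; lookup; _[_]%=_)
open import Data.Vec.Properties using (lookup∘updateAt; lookup∘updateAt′)
open import Function using (_∘_; _⇔_; mk⇔)
open import Level using (0ℓ)
open import Relation.Binary.PropositionalEquality
open import Relation.Nullary using (Dec; ¬_; does; yes; no; ¬?; _×-dec_; _⊎-dec_; contradiction)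
open import Relation.Nullary.Decidable using (dec-true; dec-false; does-⇔; decidable-stable)
open import Relation.Unary using (Pred; Decidable)

open CommSemigroup +-commutativeSemigroup using () renaming (interchange to +-interchange)
open CommSemigroup *-commutativeSemigroup using () renaming (interchange to *-interchange; xy∙z≈xz∙y to *-right-swap)

private variable A B C : Set

-- Finite sums and counting

𝟙 : Bool → ℕ
𝟙 true  = 1
𝟙 false = 0

𝟙-∧ : ∀ a b → 𝟙 (a ∧ b) ≡ 𝟙 a * 𝟙 b
𝟙-∧ true  b = sym (+-identityʳ (𝟙 b))
𝟙-∧ false b = refl

𝟙-∨ : ∀ a b → 𝟙 (a ∨ b) ≤ 𝟙 a + 𝟙 b
𝟙-∨ true  b = s≤s z≤n
𝟙-∨ false b = ≤-refl

𝟙-not : ∀ b → 𝟙 b + 𝟙 (not b) ≡ 1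
𝟙-not true  = refl
𝟙-not false = refl

𝟙-split : ∀ a b → 𝟙 b ≡ 𝟙 (a ∧ b) + 𝟙 (not a ∧ b)
𝟙-split true  b = sym (+-identityʳ (𝟙 b))
𝟙-split false b = refl

∑ : List A → (A → ℕ) → ℕ
∑ []       f = 0
∑ (x ∷ xs) f = f x + ∑ xs f

syntax ∑ xs (λ x → e) = ∑[ x ∈ xs ] e

∑-cong : ∀ (xs : List A) {f g : A → ℕ} → (∀ x → f x ≡ g x) → ∑ xs f ≡ ∑ xs g
∑-cong []       f≗g = refl
∑-cong (x ∷ xs) f≗g = cong₂ _+_ (f≗g x) (∑-cong xs f≗g)

∑-mono-≤ : ∀ (xs : List A) {f g : A → ℕ} → (∀ {x} → x ∈ xs → f x ≤ g x) → ∑ xs f ≤ ∑ xs g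
∑-mono-≤ []       f≤g = z≤n
∑-mono-≤ (x ∷ xs) f≤g = +-mono-≤ (f≤g (here refl)) (∑-mono-≤ xs (f≤g ∘ there))

∑-const : ∀ (xs : List A) c → ∑[ _ ∈ xs ] c ≡ length xs * c
∑-const []       c = refl
∑-const (x ∷ xs) c = cong (c +_) (∑-const xs c)

length≡∑1 : ∀ (xs : List A) → length xs ≡ ∑[ _ ∈ xs ] 1
length≡∑1 xs = sym (trans (∑-const xs 1) (*-identityʳ (length xs)))

∑-distrib-+ : ∀ (xs : List A) f g → ∑[ x ∈ xs ] (f x + g x) ≡ ∑ xs f + ∑ xs g
∑-distrib-+ []       f g = refl
∑-distrib-+ (x ∷ xs) f g =
  trans (cong (f x + g x +_) (∑-distrib-+ xs f g)) (+-interchange (f x) (g x) (∑ xs f) (∑ xs g))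

*-distribʳ-∑ : ∀ (xs : List A) f c → ∑ xs f * c ≡ ∑[ x ∈ xs ] (f x * c)
*-distribʳ-∑ []       f c = refl
*-distribʳ-∑ (x ∷ xs) f c = trans (*-distribʳ-+ c (f x) (∑ xs f)) (cong (f x * c +_) (*-distribʳ-∑ xs f c))

*-distribˡ-∑ : ∀ (xs : List A) c f → c * ∑ xs f ≡ ∑[ x ∈ xs ] (c * f x)
*-distribˡ-∑ xs c f = trans (*-comm c (∑ xs f)) (trans (*-distribʳ-∑ xs f c) (∑-cong xs (λ x → *-comm (f x) c)))

∑-comm : ∀ (xs : List A) (ys : List B) (h : A → B → ℕ) →
  ∑[ x ∈ xs ] ∑[ y ∈ ys ] h x y ≡ ∑[ y ∈ ys ] ∑[ x ∈ xs ] h x y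
∑-comm []       ys h = sym (trans (∑-const ys 0) (*-zeroʳ (length ys)))
∑-comm (x ∷ xs) ys h = trans (cong (∑ ys (h x) +_) (∑-comm xs ys h))
                             (sym (∑-distrib-+ ys (h x) (λ y → ∑[ x′ ∈ xs ] h x′ y)))

∑-++ : ∀ (xs ys : List A) f → ∑ (xs ++ ys) f ≡ ∑ xs f + ∑ ys f
∑-++ []       ys f = refl
∑-++ (x ∷ xs) ys f = trans (cong (f x +_) (∑-++ xs ys f)) (sym (+-assoc (f x) _ _))

∑-map : ∀ (g : A → B) xs f → ∑ (map g xs) f ≡ ∑[ x ∈ xs ] f (g x)
∑-map g []       f = refl
∑-map g (x ∷ xs) f = cong (f (g x) +_) (∑-map g xs f)

∑-cartesianProductWith : ∀ (g : A → B → C) xs ys (f : C → ℕ) →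
  ∑ (cartesianProductWith g xs ys) f ≡ ∑[ x ∈ xs ] ∑[ y ∈ ys ] f (g x y)
∑-cartesianProductWith g []       ys f = refl
∑-cartesianProductWith g (x ∷ xs) ys f =
  trans (∑-++ (map (g x) ys) _ f) (cong₂ _+_ (∑-map (g x) ys f) (∑-cartesianProductWith g xs ys f))

length-allFin : ∀ n → length (allFin n) ≡ n
length-allFin n = length-tabulate (λ i → i)

∑-allFin-suc : ∀ {M} (f : Fin (suc M) → ℕ) → ∑ (allFin (suc M)) f ≡ f zero + ∑ (allFin M) (f ∘ suc)
∑-allFin-suc {M} f =
  cong (f zero +_) (trans (cong (λ ls → ∑ ls f) (sym (map-tabulate (λ l → l) suc))) (∑-map suc (allFin M) f))

∑≡0⇒≡0 : ∀ (xs : List A) f → ∑ xs f ≡ 0 → ∀ {x} → x ∈ xs → f x ≡ 0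
∑≡0⇒≡0 (y ∷ xs) f ∑≡0 (here refl)  = m+n≡0⇒m≡0 (f y) ∑≡0
∑≡0⇒≡0 (y ∷ xs) f ∑≡0 (there x∈xs) = ∑≡0⇒≡0 xs f (m+n≡0⇒n≡0 (f y) ∑≡0) x∈xs

∑<length⇒∃≡0 : ∀ (xs : List A) f → ∑ xs f < length xs → ∃ λ x → f x ≡ 0
∑<length⇒∃≡0 (x ∷ xs) f ∑<len with f x in fx≡
... | zero  = x , fx≡
... | suc a = ∑<length⇒∃≡0 xs f (≤-trans (s≤s (m≤n+m (∑ xs f) a)) (≤-pred ∑<len))

count : ∀ {P : Pred A 0ℓ} → List A → Decidable P → ℕ
count xs P? = ∑[ x ∈ xs ] 𝟙 (does (P? x))

count-⇔ : ∀ {P Q : Pred A 0ℓ} (xs : List A) (P? : Decidable P) (Q? : Decidable Q) →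
  (∀ x → P x ⇔ Q x) → count xs P? ≡ count xs Q?
count-⇔ xs P? Q? P⇔Q = ∑-cong xs (λ x → cong 𝟙 (does-⇔ (P⇔Q x) (P? x) (Q? x)))

count-+-count-¬ : ∀ {P : Pred A 0ℓ} (xs : List A) (P? : Decidable P) →
  count xs P? + count xs (¬? ∘ P?) ≡ length xs
count-+-count-¬ xs P? = begin
  count xs P? + count xs (¬? ∘ P?)                         ≡⟨ ∑-distrib-+ xs _ _ ⟨
  ∑[ x ∈ xs ] (𝟙 (does (P? x)) + 𝟙 (not (does (P? x))))    ≡⟨ ∑-cong xs (λ x → 𝟙-not (does (P? x))) ⟩
  ∑[ _ ∈ xs ] 1                                            ≡⟨ length≡∑1 xs ⟨
  length xs                                                ∎
  where open ≡-Reasoning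

∀¬⇒count≡0 : ∀ {P : Pred A 0ℓ} (xs : List A) (P? : Decidable P) → (∀ x → ¬ P x) → count xs P? ≡ 0
∀¬⇒count≡0 xs P? ¬P =
  trans (∑-cong xs (λ x → cong 𝟙 (dec-false (P? x) (¬P x)))) (trans (∑-const xs 0) (*-zeroʳ (length xs)))

count≡0⇒¬ : ∀ {P : Pred A 0ℓ} (xs : List A) (P? : Decidable P) → count xs P? ≡ 0 → ∀ {x} → x ∈ xs → ¬ P x
count≡0⇒¬ xs P? count≡0 {x} x∈xs Px with P? x | ∑≡0⇒≡0 xs _ count≡0 x∈xs
... | yes _  | ()
... | no ¬Px | _  = ¬Px Px

count-≟ : ∀ {M} (c : Fin M) → count (allFin M) (_≟ c) ≡ 1
count-≟ {suc M} zero    = trans (∑-allFin-suc {M} (λ l → 𝟙 (does (l ≟ zero))))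
                                (cong suc (trans (∑-const (allFin M) 0) (*-zeroʳ (length (allFin M)))))
count-≟ {suc M} (suc c) = trans (∑-allFin-suc {M} (λ l → 𝟙 (does (l ≟ suc c)))) (count-≟ c)

module _ {M : ℕ} where
  open import Data.List.Membership.DecPropositional (_≟_ {M}) using (_∈?_)

  count-∈-≤ : ∀ (cs : List (Fin M)) → count (allFin M) (_∈? cs) ≤ length cs
  count-∈-≤ []       = ≤-reflexive (trans (∑-const (allFin M) 0) (*-zeroʳ (length (allFin M))))
  count-∈-≤ (c ∷ cs) = begin
    ∑[ l ∈ allFin M ] 𝟙 (does (l ≟ c) ∨ does (l ∈? cs))
      ≤⟨ ∑-mono-≤ (allFin M) (λ {l} _ → 𝟙-∨ (does (l ≟ c)) _) ⟩
    ∑[ l ∈ allFin M ] (𝟙 (does (l ≟ c)) + 𝟙 (does (l ∈? cs)))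
      ≡⟨ ∑-distrib-+ (allFin M) _ _ ⟩
    count (allFin M) (_≟ c) + count (allFin M) (_∈? cs)
      ≤⟨ +-mono-≤ (≤-reflexive (count-≟ c)) (count-∈-≤ cs) ⟩
    suc (length cs) ∎
    where open ≤-Reasoning

union-bound : ∀ {R Ω : Set} {Ev : R → Ω → Set} (ev? : ∀ r ω → Dec (Ev r ω)) (rs : List R) (ωs : List Ω) N →
  0 < length ωs → length rs < N → (∀ {r} → r ∈ rs → count ωs (ev? r) * N ≤ length ωs) →
  ∃ λ ω → ∀ {r} → r ∈ rs → ¬ Ev r ω
union-bound {Ω = Ω} ev? rs ωs N ωs≢[] rs<N rare = ω , count≡0⇒¬ rs (λ r → ev? r ω) none
  where
  open ≤-Reasoning
  total<′ : ∑[ ω ∈ ωs ] count rs (λ r → ev? r ω) * N < length ωs * N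
  total<′ = begin-strict
    ∑[ ω ∈ ωs ] count rs (λ r → ev? r ω) * N  ≡⟨ cong (_* N) (∑-comm ωs rs _) ⟩
    ∑[ r ∈ rs ] count ωs (ev? r) * N          ≡⟨ *-distribʳ-∑ rs _ N ⟩
    ∑[ r ∈ rs ] (count ωs (ev? r) * N)        ≤⟨ ∑-mono-≤ rs rare ⟩
    ∑[ _ ∈ rs ] length ωs                     ≡⟨ ∑-const rs (length ωs) ⟩
    length rs * length ωs                     <⟨ *-monoˡ-< (length ωs) {{>-nonZero ωs≢[]}} rs<N ⟩
    N * length ωs                             ≡⟨ *-comm N (length ωs) ⟩
    length ωs * N                             ∎
  found : ∃ λ ω → count rs (λ r → ev? r ω) ≡ 0
  found = ∑<length⇒∃≡0 ωs (λ ω → count rs (λ r → ev? r ω)) (*-cancelʳ-< N _ _ total<′)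
  ω : Ω
  ω = proj₁ found
  none : count rs (λ r → ev? r ω) ≡ 0
  none = proj₂ found

-- Enumerations

length-cartesianProductWith : ∀ (g : A → B → C) xs ys →
  length (cartesianProductWith g xs ys) ≡ length xs * length ys
length-cartesianProductWith g xs ys = begin
  length (cartesianProductWith g xs ys) ≡⟨ length≡∑1 (cartesianProductWith g xs ys) ⟩
  ∑ (cartesianProductWith g xs ys) _    ≡⟨ ∑-cartesianProductWith g xs ys _ ⟩
  ∑[ _ ∈ xs ] ∑[ _ ∈ ys ] 1             ≡⟨ ∑-const xs _ ⟩
  length xs * ∑[ _ ∈ ys ] 1             ≡⟨ cong (length xs *_) (length≡∑1 ys) ⟨
  length xs * length ys                 ∎
  where open ≡-Reasoning

vectors : ∀ n → List A → List (Vec A n)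
vectors zero    xs = [] ∷ []
vectors (suc n) xs = cartesianProductWith _∷_ xs (vectors n xs)

length-vectors : ∀ n (xs : List A) → length (vectors n xs) ≡ length xs ^ n
length-vectors zero    xs = refl
length-vectors (suc n) xs =
  trans (length-cartesianProductWith _∷_ xs (vectors n xs)) (cong (length xs *_) (length-vectors n xs))

listsShorterThan : ℕ → List A → List (List A)
listsShorterThan zero    xs = []
listsShorterThan (suc n) xs = [] ∷ cartesianProductWith _∷_ xs (listsShorterThan n xs)

∈-listsShorterThan⁺ : ∀ {n} {xs : List A} → (∀ x → x ∈ xs) →
  ∀ ys → length ys < n → ys ∈ listsShorterThan n xs
∈-listsShorterThan⁺ {n = suc n} all∈ []       _           = here refl
∈-listsShorterThan⁺ {n = suc n} all∈ (y ∷ ys) (s≤s len<n) =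
  there (∈-cartesianProductWith⁺ _∷_ (all∈ y) (∈-listsShorterThan⁺ all∈ ys len<n))

∈-listsShorterThan⁻ : ∀ n (xs : List A) {ys} → ys ∈ listsShorterThan n xs → length ys < n
∈-listsShorterThan⁻ (suc n) xs (here refl) = s≤s z≤n
∈-listsShorterThan⁻ (suc n) xs (there ys∈)
  with _ , _ , _ , zs∈ , refl ← ∈-cartesianProductWith⁻ _∷_ xs (listsShorterThan n xs) ys∈ =
  s≤s (∈-listsShorterThan⁻ n xs zs∈)

length-listsShorterThan : ∀ n (xs : List A) → length (listsShorterThan n xs) ≤ suc (length xs) ^ n
length-listsShorterThan zero    xs = z≤n
length-listsShorterThan (suc n) xs = begin
  suc (length (cartesianProductWith _∷_ xs yss))        ≡⟨ cong suc (length-cartesianProductWith _∷_ xs yss) ⟩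
  suc (length xs * length yss)                          ≤⟨ s≤s (*-monoʳ-≤ (length xs) (length-listsShorterThan n xs)) ⟩
  suc (length xs * suc (length xs) ^ n)                 ≤⟨ +-monoˡ-≤ _ (m^n>0 (suc (length xs)) n) ⟩
  suc (length xs) ^ n + length xs * suc (length xs) ^ n ≡⟨⟩
  suc (length xs) ^ suc n                               ∎
  where
  open ≤-Reasoning
  yss : List (List _)
  yss = listsShorterThan n xs

-- Bit vectors satisfying prescribed values at distinct positions

bools : List Bool
bools = false ∷ true ∷ []

∈-bools : ∀ b → b ∈ bools
∈-bools false = here refl
∈-bools true  = there (here refl)

∑-flip-invariant : ∀ {Q} (q : Fin Q) (f : Vec Bool Q → ℕ) →
  ∑[ τ ∈ vectors Q bools ] f (τ [ q ]%= not) ≡ ∑ (vectors Q bools) f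
∑-flip-invariant {suc Q} zero    f = begin
  ∑[ τ ∈ vectors (suc Q) bools ] f (τ [ zero ]%= not)
    ≡⟨ ∑-cartesianProductWith _∷_ bools τs _ ⟩
  ∑[ τ ∈ τs ] f (true ∷ τ) + (∑[ τ ∈ τs ] f (false ∷ τ) + 0)
    ≡⟨ x+[y+0]≡y+[x+0] (∑[ τ ∈ τs ] f (true ∷ τ)) _ ⟩
  ∑[ τ ∈ τs ] f (false ∷ τ) + (∑[ τ ∈ τs ] f (true ∷ τ) + 0)
    ≡⟨ ∑-cartesianProductWith _∷_ bools τs f ⟨
  ∑ (vectors (suc Q) bools) f ∎
  where
  open ≡-Reasoning
  τs : List (Vec Bool Q)
  τs = vectors Q bools
  x+[y+0]≡y+[x+0] : ∀ x y → x + (y + 0) ≡ y + (x + 0)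
  x+[y+0]≡y+[x+0] x y = trans (+-comm x (y + 0)) (trans (+-assoc y 0 x) (cong (y +_) (sym (+-identityʳ x))))
∑-flip-invariant {suc Q} (suc q) f =
  trans (∑-cartesianProductWith _∷_ bools (vectors Q bools) _)
        (trans (∑-cong bools (λ b → ∑-flip-invariant q (f ∘ (b ∷_))))
               (sym (∑-cartesianProductWith _∷_ bools (vectors Q bools) f)))

does-not-≟ : ∀ b t → does (not b ≟ᵇ t) ≡ not (does (b ≟ᵇ t))
does-not-≟ false false = refl
does-not-≟ false true  = refl
does-not-≟ true  false = refl
does-not-≟ true  true  = refl

count-fixing-bit : ∀ {Q} (q : Fin Q) t {P : Pred (Vec Bool Q) 0ℓ} (P? : Decidable P) →
  (∀ τ → P (τ [ q ]%= not) ⇔ P τ) →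
  count (vectors Q bools) (λ τ → (lookup τ q ≟ᵇ t) ×-dec P? τ) * 2 ≡ count (vectors Q bools) P?
count-fixing-bit {Q} q t P? flip-invariant = begin
  fixed * 2                                          ≡⟨ trans (*-comm fixed 2) (cong (fixed +_) (+-identityʳ fixed)) ⟩
  fixed + fixed                                      ≡⟨ cong (fixed +_) flipped≡fixed ⟨
  fixed + ∑[ τ ∈ τs ] 𝟙 (not (c τ) ∧ p τ)            ≡⟨ ∑-distrib-+ τs _ _ ⟨
  ∑[ τ ∈ τs ] (𝟙 (c τ ∧ p τ) + 𝟙 (not (c τ) ∧ p τ))  ≡⟨ ∑-cong τs (λ τ → 𝟙-split (c τ) (p τ)) ⟨
  count τs P?                                        ∎
  where
  open ≡-Reasoning
  τs : List (Vec Bool Q)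
  τs = vectors Q bools
  c p : Vec Bool Q → Bool
  c τ = does (lookup τ q ≟ᵇ t)
  p τ = does (P? τ)
  fixed : ℕ
  fixed = ∑[ τ ∈ τs ] 𝟙 (c τ ∧ p τ)
  flip-swaps : ∀ τ → 𝟙 (not (c (τ [ q ]%= not)) ∧ p (τ [ q ]%= not)) ≡ 𝟙 (c τ ∧ p τ)
  flip-swaps τ rewrite lookup∘updateAt q {not} τ | does-not-≟ (lookup τ q) t
                     | does-⇔ (flip-invariant τ) (P? (τ [ q ]%= not)) (P? τ) | not-involutive (c τ) = refl
  flipped≡fixed : ∑[ τ ∈ τs ] 𝟙 (not (c τ) ∧ p τ) ≡ fixed
  flipped≡fixed = trans (sym (∑-flip-invariant q (λ τ → 𝟙 (not (c τ) ∧ p τ)))) (∑-cong τs flip-swaps)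

Satisfies : ∀ {Q} → Vec Bool Q → List (Fin Q × Bool) → Set
Satisfies τ = All (λ (q , t) → lookup τ q ≡ t)

satisfies? : ∀ {Q} (cs : List (Fin Q × Bool)) → Decidable (λ τ → Satisfies τ cs)
satisfies? cs τ = All.all? (λ (q , t) → lookup τ q ≟ᵇ t) cs

Satisfies-cong : ∀ {Q} {q : Fin Q} (τ τ′ : Vec Bool Q) cs → All (q ≢_) (map proj₁ cs) →
  (∀ {q′} → q ≢ q′ → lookup τ q′ ≡ lookup τ′ q′) → Satisfies τ cs → Satisfies τ′ cs
Satisfies-cong τ τ′ []       []           same []         = []
Satisfies-cong τ τ′ (_ ∷ cs) (q≢q′ ∷ q∉) same (eq ∷ sat) =
  trans (sym (same q≢q′)) eq ∷ Satisfies-cong τ τ′ cs q∉ same sat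

Satisfies-flip : ∀ {Q} {q : Fin Q} τ cs → All (q ≢_) (map proj₁ cs) →
  Satisfies (τ [ q ]%= not) cs ⇔ Satisfies τ cs
Satisfies-flip {q = q} τ cs q∉cs =
  mk⇔ (Satisfies-cong (τ [ q ]%= not) τ cs q∉cs unflipped)
      (Satisfies-cong τ (τ [ q ]%= not) cs q∉cs (sym ∘ unflipped))
  where
  unflipped : ∀ {q q′} → q ≢ q′ → lookup (τ [ q ]%= not) q′ ≡ lookup τ q′
  unflipped q≢q′ = lookup∘updateAt′ _ _ (q≢q′ ∘ sym) τ

count-satisfies : ∀ {Q} (cs : List (Fin Q × Bool)) → Unique (map proj₁ cs) →
  count (vectors Q bools) (satisfies? cs) * 2 ^ length cs ≡ 2 ^ Q
count-satisfies {Q} [] _ =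
  trans (*-identityʳ _) (trans (sym (length≡∑1 (vectors Q bools))) (length-vectors Q bools))
count-satisfies {Q} ((q , t) ∷ cs) (q∉cs ∷ unique) = begin
  count τs (satisfies? ((q , t) ∷ cs)) * (2 * 2 ^ length cs) ≡⟨ *-assoc (count τs (satisfies? ((q , t) ∷ cs))) 2 _ ⟨
  count τs (satisfies? ((q , t) ∷ cs)) * 2 * 2 ^ length cs   ≡⟨ cong (_* 2 ^ length cs) fix-q ⟩
  count τs (satisfies? cs) * 2 ^ length cs                   ≡⟨ count-satisfies cs unique ⟩
  2 ^ Q                                                      ∎
  where
  open ≡-Reasoning
  τs : List (Vec Bool Q)
  τs = vectors Q bools
  fix-q : count τs (satisfies? ((q , t) ∷ cs)) * 2 ≡ count τs (satisfies? cs)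
  fix-q = count-fixing-bit q t (satisfies? cs) (λ τ → Satisfies-flip τ cs q∉cs)

count-violating : ∀ {Q} (cs : List (Fin Q × Bool)) → Unique (map proj₁ cs) →
  count (vectors Q bools) (¬? ∘ satisfies? cs) * 2 ^ length cs ≡ length (vectors Q bools) * (2 ^ length cs ∸ 1)
count-violating {Q} cs unique = begin
  bad * D                 ≡⟨ m+n∸n≡m (bad * D) L ⟨
  bad * D + L ∸ L         ≡⟨ cong (λ x → bad * D + x ∸ L) L≡good*D ⟩
  bad * D + good * D ∸ L  ≡⟨ cong (_∸ L) (*-distribʳ-+ D bad good) ⟨
  (bad + good) * D ∸ L    ≡⟨ cong (λ x → x * D ∸ L) bad+good≡L ⟩
  L * D ∸ L               ≡⟨ cong (L * D ∸_) (*-identityʳ L) ⟨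
  L * D ∸ L * 1           ≡⟨ *-distribˡ-∸ L D 1 ⟨
  L * (D ∸ 1)             ∎
  where
  open ≡-Reasoning
  τs : List (Vec Bool Q)
  τs = vectors Q bools
  L D good bad : ℕ
  L = length τs
  D = 2 ^ length cs
  good = count τs (satisfies? cs)
  bad = count τs (¬? ∘ satisfies? cs)
  L≡good*D : L ≡ good * D
  L≡good*D = trans (length-vectors Q bools) (sym (count-satisfies cs unique))
  bad+good≡L : bad + good ≡ L
  bad+good≡L = trans (+-comm bad good) (count-+-count-¬ τs (satisfies? cs))

-- Independent slots

freeCount : ∀ {M} {F : Pred (Fin M) 0ℓ} → Decidable F → ℕ
freeCount {M} F? = count (allFin M) (¬? ∘ F?)

module _ {X : Set} where

  EveryFreeSlot : ∀ {M} → Pred (Fin M) 0ℓ → (Fin M → X → Vec X M → Set) → Vec X M → Set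
  EveryFreeSlot F B ω = ∀ l → F l ⊎ B l (lookup ω l) ω

  everyFreeSlot? : ∀ {M} {F : Pred (Fin M) 0ℓ} {B : Fin M → X → Vec X M → Set} →
    Decidable F → (∀ l x ω → Dec (B l x ω)) → Decidable (EveryFreeSlot F B)
  everyFreeSlot? F? B? ω = all? (λ l → F? l ⊎-dec B? l (lookup ω l) ω)

  EveryFreeSlot-map : ∀ {M} {F : Pred (Fin M) 0ℓ} {B B′ : Fin M → X → Vec X M → Set} {ω} →
    (∀ l x → B l x ω → B′ l x ω) → EveryFreeSlot F B ω → EveryFreeSlot F B′ ω
  EveryFreeSlot-map B⇒B′ every l = Sum.map₂ (B⇒B′ l _) (every l)

  ¬EveryFreeSlot⇒ : ∀ {M} {F : Pred (Fin M) 0ℓ} {B : Fin M → X → Vec X M → Set} (F? : Decidable F)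
    (B? : ∀ l x ω → Dec (B l x ω)) {ω} → ¬ EveryFreeSlot F B ω → ∃ λ l → ¬ F l × ¬ B l (lookup ω l) ω
  ¬EveryFreeSlot⇒ {M} F? B? {ω} ¬every
    with l , ¬[F⊎B] ← ¬∀⟶∃¬ M _ (λ l → F? l ⊎-dec B? l (lookup ω l) ω) ¬every =
    l , ¬[F⊎B] ∘ inj₁ , ¬[F⊎B] ∘ inj₂

  AgreeOn : ∀ {M} → Pred (Fin M) 0ℓ → Vec X M → Vec X M → Set
  AgreeOn F ω ω′ = ∀ j → F j → lookup ω j ≡ lookup ω′ j

  AgreeOn-∷ : ∀ {M} {F : Pred (Fin (suc M)) 0ℓ} {ω ω′ : Vec X M} x →
    AgreeOn (F ∘ suc) ω ω′ → AgreeOn F (x ∷ ω) (x ∷ ω′)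
  AgreeOn-∷ x agree zero    _  = refl
  AgreeOn-∷ x agree (suc j) Fj = agree j Fj

  AgreeOn-free : ∀ {M} {F : Pred (Fin (suc M)) 0ℓ} (ω : Vec X M) {x y} → ¬ F zero → AgreeOn F (x ∷ ω) (y ∷ ω)
  AgreeOn-free ω ¬F₀ zero    F₀ = contradiction F₀ ¬F₀
  AgreeOn-free ω ¬F₀ (suc j) _  = refl

  module FirstSlot {M} {F : Pred (Fin (suc M)) 0ℓ} (F? : Decidable F)
    {B : Fin (suc M) → X → Vec X (suc M) → Set} (B? : ∀ l x ω → Dec (B l x ω))
    (local : ∀ l x {ω ω′} → AgreeOn F ω ω′ → B l x ω → B l x ω′) (xs : List X) where

    Bᵗ : X → Fin M → X → Vec X M → Set
    Bᵗ x₀ l x ω = B (suc l) x (x₀ ∷ ω)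

    Bᵗ? : ∀ x₀ l x ω → Dec (Bᵗ x₀ l x ω)
    Bᵗ? x₀ l x ω = B? (suc l) x (x₀ ∷ ω)

    localᵗ : ∀ x₀ l x {ω ω′} → AgreeOn (F ∘ suc) ω ω′ → Bᵗ x₀ l x ω → Bᵗ x₀ l x ω′
    localᵗ x₀ l x agree = local (suc l) x (AgreeOn-∷ x₀ agree)

    tail? : ∀ x₀ → Decidable (EveryFreeSlot (F ∘ suc) (Bᵗ x₀))
    tail? x₀ = everyFreeSlot? (F? ∘ suc) (Bᵗ? x₀)

    freeCount-frozen : F zero → freeCount F? ≡ freeCount (F? ∘ suc)
    freeCount-frozen F₀ = trans (∑-allFin-suc (λ l → 𝟙 (does (¬? (F? l)))))
                                (cong (λ b → 𝟙 (not b) + freeCount (F? ∘ suc)) (dec-true (F? zero) F₀))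

    freeCount-free : ¬ F zero → freeCount F? ≡ suc (freeCount (F? ∘ suc))
    freeCount-free ¬F₀ = trans (∑-allFin-suc (λ l → 𝟙 (does (¬? (F? l)))))
                               (cong (λ b → 𝟙 (not b) + freeCount (F? ∘ suc)) (dec-false (F? zero) ¬F₀))

    count-frozen : F zero →
      count (vectors (suc M) xs) (everyFreeSlot? F? B?) ≡ ∑[ x₀ ∈ xs ] count (vectors M xs) (tail? x₀)
    count-frozen F₀ = trans (∑-cartesianProductWith _∷_ xs (vectors M xs) _)
      (∑-cong xs λ x₀ → ∑-cong (vectors M xs) λ ω →
        cong (λ b → 𝟙 ((b ∨ does (B? zero x₀ (x₀ ∷ ω))) ∧ does (tail? x₀ ω))) (dec-true (F? zero) F₀))

    -- If slot 0 is free, the tests see its value only as their own argument, so inside ω it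
    -- may be replaced by a fixed x*, and the event factorises.
    𝟙-free : ¬ F zero → ∀ x* x₀ ω →
      𝟙 (does (everyFreeSlot? F? B? (x₀ ∷ ω))) ≡ 𝟙 (does (B? zero x₀ (x* ∷ ω))) * 𝟙 (does (tail? x* ω))
    𝟙-free ¬F₀ x* x₀ ω = begin
      𝟙 ((does (F? zero) ∨ does (B? zero x₀ (x₀ ∷ ω))) ∧ does (tail? x₀ ω))
        ≡⟨ cong (λ f → 𝟙 ((f ∨ does (B? zero x₀ (x₀ ∷ ω))) ∧ does (tail? x₀ ω))) (dec-false (F? zero) ¬F₀) ⟩
      𝟙 (does (B? zero x₀ (x₀ ∷ ω)) ∧ does (tail? x₀ ω))
        ≡⟨ cong₂ (λ b t → 𝟙 (b ∧ t)) (does-⇔ slot₀⇔ (B? zero x₀ (x₀ ∷ ω)) (B? zero x₀ (x* ∷ ω)))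
                                     (does-⇔ tail⇔ (tail? x₀ ω) (tail? x* ω)) ⟩
      𝟙 (does (B? zero x₀ (x* ∷ ω)) ∧ does (tail? x* ω))
        ≡⟨ 𝟙-∧ (does (B? zero x₀ (x* ∷ ω))) (does (tail? x* ω)) ⟩
      𝟙 (does (B? zero x₀ (x* ∷ ω))) * 𝟙 (does (tail? x* ω)) ∎
      where
      open ≡-Reasoning
      to : AgreeOn F (x₀ ∷ ω) (x* ∷ ω)
      to = AgreeOn-free ω ¬F₀
      from : AgreeOn F (x* ∷ ω) (x₀ ∷ ω)
      from = AgreeOn-free ω ¬F₀
      slot₀⇔ : B zero x₀ (x₀ ∷ ω) ⇔ B zero x₀ (x* ∷ ω)
      slot₀⇔ = mk⇔ (local zero x₀ {x₀ ∷ ω} to) (local zero x₀ {x* ∷ ω} from)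
      tail⇔ : EveryFreeSlot (F ∘ suc) (Bᵗ x₀) ω ⇔ EveryFreeSlot (F ∘ suc) (Bᵗ x*) ω
      tail⇔ = mk⇔ (EveryFreeSlot-map {B = Bᵗ x₀} {B′ = Bᵗ x*} (λ l x → local (suc l) x {x₀ ∷ ω} to))
                  (EveryFreeSlot-map {B = Bᵗ x*} {B′ = Bᵗ x₀} (λ l x → local (suc l) x {x* ∷ ω} from))

    count-free : ¬ F zero → ∀ x* →
      count (vectors (suc M) xs) (everyFreeSlot? F? B?)
        ≡ ∑[ ω ∈ vectors M xs ] (count xs (λ x → B? zero x (x* ∷ ω)) * 𝟙 (does (tail? x* ω)))
    count-free ¬F₀ x* = begin
      count (vectors (suc M) xs) (everyFreeSlot? F? B?)
        ≡⟨ ∑-cartesianProductWith _∷_ xs ωs _ ⟩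
      ∑[ x₀ ∈ xs ] ∑[ ω ∈ ωs ] 𝟙 (does (everyFreeSlot? F? B? (x₀ ∷ ω)))
        ≡⟨ ∑-cong xs (λ x₀ → ∑-cong ωs (𝟙-free ¬F₀ x* x₀)) ⟩
      ∑[ x₀ ∈ xs ] ∑[ ω ∈ ωs ] (𝟙 (does (B? zero x₀ (x* ∷ ω))) * 𝟙 (does (tail? x* ω)))
        ≡⟨ ∑-comm xs ωs _ ⟩
      ∑[ ω ∈ ωs ] ∑[ x₀ ∈ xs ] (𝟙 (does (B? zero x₀ (x* ∷ ω))) * 𝟙 (does (tail? x* ω)))
        ≡⟨ ∑-cong ωs (λ ω → *-distribʳ-∑ xs _ _) ⟨
      ∑[ ω ∈ ωs ] (count xs (λ x → B? zero x (x* ∷ ω)) * 𝟙 (does (tail? x* ω))) ∎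
      where
      open ≡-Reasoning
      ωs : List (Vec X M)
      ωs = vectors M xs

    module _ {D E : ℕ} (IH : ∀ x₀ → count (vectors M xs) (tail? x₀) * D ^ freeCount (F? ∘ suc)
                                      ≤ length xs ^ M * E ^ freeCount (F? ∘ suc)) where

      private
        c′ : ℕ
        c′ = freeCount (F? ∘ suc)
        ωs : List (Vec X M)
        ωs = vectors M xs

      bound-frozen : F zero →
        count (vectors (suc M) xs) (everyFreeSlot? F? B?) * D ^ c′ ≤ length xs ^ suc M * E ^ c′
      bound-frozen F₀ = begin
        count (vectors (suc M) xs) (everyFreeSlot? F? B?) * D ^ c′ ≡⟨ cong (_* D ^ c′) (count-frozen F₀) ⟩
        ∑[ x₀ ∈ xs ] count ωs (tail? x₀) * D ^ c′                 ≡⟨ *-distribʳ-∑ xs _ (D ^ c′) ⟩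
        ∑[ x₀ ∈ xs ] (count ωs (tail? x₀) * D ^ c′)               ≤⟨ ∑-mono-≤ xs (λ {x₀} _ → IH x₀) ⟩
        ∑[ _ ∈ xs ] (length xs ^ M * E ^ c′)                      ≡⟨ ∑-const xs _ ⟩
        length xs * (length xs ^ M * E ^ c′)                      ≡⟨ *-assoc (length xs) _ _ ⟨
        length xs ^ suc M * E ^ c′                                ∎
        where open ≤-Reasoning

      bound-free : ¬ F zero → ∀ x* → (∀ ω → count xs (λ x → B? zero x (x* ∷ ω)) * D ≤ length xs * E) →
        count (vectors (suc M) xs) (everyFreeSlot? F? B?) * D ^ suc c′ ≤ length xs ^ suc M * E ^ suc c′
      bound-free ¬F₀ x* bound₀ = begin
        count (vectors (suc M) xs) (everyFreeSlot? F? B?) * (D * D ^ c′)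
          ≡⟨ cong (_* (D * D ^ c′)) (count-free ¬F₀ x*) ⟩
        ∑[ ω ∈ ωs ] (hits ω * rest ω) * (D * D ^ c′)
          ≡⟨ regroup ⟩
        ∑[ ω ∈ ωs ] (hits ω * D * rest ω) * D ^ c′
          ≤⟨ *-monoˡ-≤ (D ^ c′) (∑-mono-≤ ωs (λ {ω} _ → *-monoˡ-≤ (rest ω) (bound₀ ω))) ⟩
        ∑[ ω ∈ ωs ] (length xs * E * rest ω) * D ^ c′
          ≡⟨ cong (_* D ^ c′) (*-distribˡ-∑ ωs (length xs * E) rest) ⟨
        length xs * E * count ωs (tail? x*) * D ^ c′
          ≡⟨ *-assoc (length xs * E) _ _ ⟩
        length xs * E * (count ωs (tail? x*) * D ^ c′)
          ≤⟨ *-monoʳ-≤ (length xs * E) (IH x*) ⟩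
        length xs * E * (length xs ^ M * E ^ c′)
          ≡⟨ *-interchange (length xs) E (length xs ^ M) (E ^ c′) ⟩
        length xs ^ suc M * E ^ suc c′ ∎
        where
        open ≤-Reasoning
        hits rest : Vec X M → ℕ
        hits ω = count xs (λ x → B? zero x (x* ∷ ω))
        rest ω = 𝟙 (does (tail? x* ω))
        regroup : ∑[ ω ∈ ωs ] (hits ω * rest ω) * (D * D ^ c′) ≡ ∑[ ω ∈ ωs ] (hits ω * D * rest ω) * D ^ c′
        regroup = begin-equality
          ∑[ ω ∈ ωs ] (hits ω * rest ω) * (D * D ^ c′)
            ≡⟨ *-assoc (∑[ ω ∈ ωs ] (hits ω * rest ω)) D _ ⟨
          ∑[ ω ∈ ωs ] (hits ω * rest ω) * D * D ^ c′
            ≡⟨ cong (_* D ^ c′) (*-distribʳ-∑ ωs _ D) ⟩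
          ∑[ ω ∈ ωs ] (hits ω * rest ω * D) * D ^ c′
            ≡⟨ cong (_* D ^ c′) (∑-cong ωs λ ω → *-right-swap (hits ω) (rest ω) D) ⟩
          ∑[ ω ∈ ωs ] (hits ω * D * rest ω) * D ^ c′ ∎

  -- In probabilistic terms: if, whatever the values in the frozen slots (those in F), every
  -- free slot independently passes its test B with probability at most E/D, then all free
  -- slots pass with probability at most (E/D)^(number of free slots).
  count-EveryFreeSlot-≤ : ∀ (D E : ℕ) (xs : List X) {M} {F : Pred (Fin M) 0ℓ} (F? : Decidable F)
    {B : Fin M → X → Vec X M → Set} (B? : ∀ l x ω → Dec (B l x ω)) →
    (∀ l x {ω ω′} → AgreeOn F ω ω′ → B l x ω → B l x ω′) →
    (∀ l ω → ¬ F l → count xs (λ x → B? l x ω) * D ≤ length xs * E) →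
    count (vectors M xs) (everyFreeSlot? F? B?) * D ^ freeCount F? ≤ length xs ^ M * E ^ freeCount F?
  count-EveryFreeSlot-≤ D E xs              {zero}  F? B? local bound = ≤-refl
  count-EveryFreeSlot-≤ D E []              {suc M} F? B? local bound = z≤n
  count-EveryFreeSlot-≤ D E xs@(x* ∷ _) {suc M} {F} F? B? local bound = by-slot₀ (F? zero)
    where
    open FirstSlot F? B? local xs
    IH : ∀ x₀ → count (vectors M xs) (tail? x₀) * D ^ freeCount (F? ∘ suc)
                 ≤ length xs ^ M * E ^ freeCount (F? ∘ suc)
    IH x₀ = count-EveryFreeSlot-≤ D E xs (F? ∘ suc) (Bᵗ? x₀) (localᵗ x₀) (λ l ω → bound (suc l) (x₀ ∷ ω))
    by-slot₀ : Dec (F zero) →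
      count (vectors (suc M) xs) (everyFreeSlot? F? B?) * D ^ freeCount F? ≤ length xs ^ suc M * E ^ freeCount F?
    by-slot₀ (yes F₀) rewrite freeCount-frozen F₀ = bound-frozen IH F₀
    by-slot₀ (no ¬F₀) rewrite freeCount-free ¬F₀ = bound-free IH ¬F₀ x* (λ ω → bound zero (x* ∷ ω) ¬F₀)

-- Arithmetic

^-distribʳ-* : ∀ a b n → (a * b) ^ n ≡ a ^ n * b ^ n
^-distribʳ-* a b zero    = refl
^-distribʳ-* a b (suc n) = trans (cong (a * b *_) (^-distribʳ-* a b n)) (*-interchange a b (a ^ n) (b ^ n))

n<2^n : ∀ n → n < 2 ^ n
n<2^n zero    = s≤s z≤n
n<2^n (suc n) = begin-strict
  suc n           ≤⟨ n<2^n n ⟩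
  2 ^ n           <⟨ m<m+n (2 ^ n) (m^n>0 2 n) ⟩
  2 ^ n + 2 ^ n   ≡⟨ cong (2 ^ n +_) (+-identityʳ (2 ^ n)) ⟨
  2 ^ suc n       ∎
  where open ≤-Reasoning

bernoulli : ∀ a j → a ^ j * (a + j) ≤ a * suc a ^ j
bernoulli a zero    = ≤-reflexive (trans (+-identityʳ (a + 0)) (trans (+-identityʳ a) (sym (*-identityʳ a))))
bernoulli a (suc j) = begin
  a ^ suc j * (a + suc j)
    ≡⟨ solve 3 (λ a x j → (a :* x) :* (a :+ (con 1 :+ j)) := (x :* (a :+ j)) :* a :+ x :* a) refl a X j ⟩
  X * (a + j) * a + X * a
    ≤⟨ +-monoʳ-≤ (X * (a + j) * a) (*-monoʳ-≤ X (m≤m+n a j)) ⟩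
  X * (a + j) * a + X * (a + j)
    ≡⟨ solve 2 (λ a y → y :* a :+ y := (con 1 :+ a) :* y) refl a (X * (a + j)) ⟩
  suc a * (X * (a + j))
    ≤⟨ *-monoʳ-≤ (suc a) (bernoulli a j) ⟩
  suc a * (a * suc a ^ j)
    ≡⟨ solve 2 (λ a y → (con 1 :+ a) :* (a :* y) := a :* ((con 1 :+ a) :* y)) refl a (suc a ^ j) ⟩
  a * suc a ^ suc j ∎
  where
  open ≤-Reasoning
  open +-*-Solver
  X : ℕ
  X = a ^ j

^-suc-halving : ∀ a → a ^ suc a * 2 ≤ suc a ^ suc a
^-suc-halving zero       = z≤n
^-suc-halving a@(suc _) = *-cancelˡ-≤ a (begin
  a * (a ^ suc a * 2)       ≡⟨ solve 2 (λ a x → a :* (x :* con 2) := x :* (a :+ a)) refl a (a ^ suc a) ⟩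
  a ^ suc a * (a + a)       ≤⟨ *-monoʳ-≤ (a ^ suc a) (+-monoʳ-≤ a (n≤1+n a)) ⟩
  a ^ suc a * (a + suc a)   ≤⟨ bernoulli a (suc a) ⟩
  a * suc a ^ suc a         ∎)
  where
  open ≤-Reasoning
  open +-*-Solver

^-decay-+ : ∀ a s c → a ^ (s * suc a + c) * 2 ^ s ≤ suc a ^ (s * suc a + c)
^-decay-+ a zero    c = ≤-trans (≤-reflexive (*-identityʳ (a ^ c))) (^-monoˡ-≤ c (n≤1+n a))
^-decay-+ a (suc s) c = begin
  a ^ (suc s * D + c) * 2 ^ suc s          ≡⟨ cong (λ e → a ^ e * 2 ^ suc s) (+-assoc D (s * D) c) ⟩
  a ^ (D + (s * D + c)) * (2 * 2 ^ s)      ≡⟨ cong (_* (2 * 2 ^ s)) (^-distribˡ-+-* a D (s * D + c)) ⟩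
  a ^ D * a ^ (s * D + c) * (2 * 2 ^ s)    ≡⟨ *-interchange (a ^ D) (a ^ (s * D + c)) 2 (2 ^ s) ⟩
  a ^ D * 2 * (a ^ (s * D + c) * 2 ^ s)    ≤⟨ *-mono-≤ (^-suc-halving a) (^-decay-+ a s c) ⟩
  D ^ D * D ^ (s * D + c)                  ≡⟨ ^-distribˡ-+-* D D (s * D + c) ⟨
  D ^ (D + (s * D + c))                    ≡⟨ cong (D ^_) (+-assoc D (s * D) c) ⟨
  D ^ (suc s * D + c)                      ∎
  where
  open ≤-Reasoning
  D : ℕ
  D = suc a

^-decay : ∀ a s c → s * suc a ≤ c → a ^ c * 2 ^ s ≤ suc a ^ c
^-decay a s c s*D≤c = subst (λ e → a ^ e * 2 ^ s ≤ suc a ^ e) (m+[n∸m]≡n s*D≤c) (^-decay-+ a s (c ∸ s * suc a))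

≤-rescale : ∀ x y d e t .{{_ : NonZero d}} → x * d ≤ y * e → e * t ≤ d → x * t ≤ y
≤-rescale x y d e t xd≤ye et≤d = *-cancelʳ-≤ (x * t) y d (begin
  x * t * d     ≡⟨ *-right-swap x t d ⟩
  x * d * t     ≤⟨ *-monoˡ-≤ t xd≤ye ⟩
  y * e * t     ≡⟨ *-assoc y e t ⟩
  y * (e * t)   ≤⟨ *-monoʳ-≤ y et≤d ⟩
  y * d         ∎)
  where open ≤-Reasoning

-- m leaves at least 2^p·s free levels for every request size p < n, while s is so large that
-- the number of requests, which is polynomial in s, stays below 2^s.
module Parameters (n k : ℕ) where

  private
    c a w : ℕ
    c = k * 2 * (suc n + 2 ^ n * suc n) + 1
    a = c ^ n * k
    w = suc a

  s m : ℕ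
  s = w * suc n
  m = n + 2 ^ n * s

  m-large : ∀ p → p < n → s * 2 ^ p + suc p ≤ suc m
  m-large p p<n = begin
    s * 2 ^ p + suc p   ≤⟨ +-mono-≤ (*-monoʳ-≤ s (^-monoʳ-≤ 2 (<⇒≤ p<n))) p<n ⟩
    s * 2 ^ n + n       ≡⟨ trans (cong (_+ n) (*-comm s (2 ^ n))) (+-comm (2 ^ n * s) n) ⟩
    m                   ≤⟨ n≤1+n m ⟩
    suc m               ∎
    where open ≤-Reasoning

  private
    linear : suc (k * suc m * 2) ≤ w * c
    linear = begin
      suc (k * suc m * 2)
        ≡⟨ solve 4 (λ k n P a → con 1 :+ k :* (con 1 :+ (n :+ P :* ((con 1 :+ a) :* (con 1 :+ n)))) :* con 2
                             := (k :* con 2 :* ((con 1 :+ n) :+ P :* (con 1 :+ n)) :+ con 1)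
                                :+ a :* (k :* con 2 :* (P :* (con 1 :+ n))))
                   refl k n (2 ^ n) a ⟩
      c + a * (k * 2 * (2 ^ n * suc n))
        ≤⟨ +-monoʳ-≤ c (*-monoʳ-≤ a (≤-trans (*-monoʳ-≤ (k * 2) (m≤n+m _ (suc n))) (m≤m+n _ 1))) ⟩
      c + a * c ∎
      where
      open ≤-Reasoning
      open +-*-Solver

  s-large : suc (k * suc m * 2) ^ n * k < 2 ^ s
  s-large = begin-strict
    suc (k * suc m * 2) ^ n * k   ≤⟨ *-monoˡ-≤ k (^-monoˡ-≤ n linear) ⟩
    (w * c) ^ n * k               ≡⟨ trans (cong (_* k) (^-distribʳ-* w c n)) (*-assoc (w ^ n) (c ^ n) k) ⟩
    w ^ n * a                     <⟨ *-monoʳ-< (w ^ n) {{m^n≢0 w n}} (n<1+n a) ⟩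
    w ^ n * w                     ≡⟨ *-comm (w ^ n) w ⟩
    w ^ suc n                     ≤⟨ ^-monoˡ-≤ (suc n) (<⇒≤ (n<2^n w)) ⟩
    (2 ^ w) ^ suc n               ≡⟨ ^-*-assoc 2 w (suc n) ⟩
    2 ^ s                         ∎
    where open ≤-Reasoning

-- The random graph H_m

module Model (k m : ℕ) where

  Vertex : Set
  Vertex = Fin k × Fin (suc m)

  _≟ᵛ_ : (x y : Vertex) → Dec (x ≡ y)
  _≟ᵛ_ = ≡-dec _≟_ _≟_

  open import Data.List.Membership.DecPropositional (_≟_ {suc m}) using (_∈?_)
  open import Data.List.Relation.Unary.Unique.DecPropositional _≟ᵛ_ using (unique?)

  level : Vertex → Fin (suc m)
  level = proj₂

  Table : Set
  Table = Vec Bool (k * suc m)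

  Outcome : Set
  Outcome = Vec Table (suc m)

  index : Vertex → Fin (k * suc m)
  index (i , t) = combine i t

  index-injective : ∀ {x y} → index x ≡ index y → x ≡ y
  index-injective {i , t} {j , u} eq with refl , refl ← combine-injective i t j u eq = refl

  bit : Outcome → Vertex → Vertex → Bool
  bit ω x y = lookup (lookup ω (level x)) (index y)

  coin : Outcome → Vertex → Vertex → Bool
  coin ω x y = bit ω x y xor bit ω y x

  coins : Outcome → Coins k m
  coins ω = coin ω , λ x y → xor-comm (bit ω x y) (bit ω y x)

  -- For a vertex a off the level of v, coin ω a v ≡ b iff the table of v's level holds
  -- b xor bit ω a v at index a.
  constraints : List (Vertex × Bool) → Vertex → Outcome → List (Fin (k * suc m) × Bool)
  constraints R v ω = map (λ (a , b) → index a , b xor bit ω a v) R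

  levels : List (Vertex × Bool) → List (Fin (suc m))
  levels R = map level (map proj₁ R)

  -- Level 0 is blocked because there the coins do not decide the edges (rule (i)).
  Blocked : List (Vertex × Bool) → Pred (Fin (suc m)) 0ℓ
  Blocked R l = l ∈ zero ∷ levels R

  blocked? : ∀ R → Decidable (Blocked R)
  blocked? R l = l ∈? zero ∷ levels R

  Fails : List (Vertex × Bool) → Fin k → Fin (suc m) → Table → Outcome → Set
  Fails R i l τ ω = ¬ Satisfies τ (constraints R (i , l) ω)

  fails? : ∀ R i l τ ω → Dec (Fails R i l τ ω)
  fails? R i l τ ω = ¬? (satisfies? (constraints R (i , l) ω) τ)

  Bad : List (Vertex × Bool) → Fin k → Outcome → Set
  Bad R i ω = Unique (map proj₁ R) × EveryFreeSlot (Blocked R) (Fails R i) ω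

  bad? : ∀ R i → Decidable (Bad R i)
  bad? R i ω = unique? (map proj₁ R) ×-dec everyFreeSlot? (blocked? R) (fails? R i) ω

  Fails-local : ∀ R i l τ {ω ω′} → AgreeOn (Blocked R) ω ω′ → Fails R i l τ ω → Fails R i l τ ω′
  Fails-local R i l τ agree = subst (λ cs → ¬ Satisfies τ cs) (map-cong-local (All.tabulate λ {(a , b)} a∈R →
    cong (λ τ′ → index a , b xor lookup τ′ (index (i , l)))
         (agree (level a) (there (∈-map⁺ level (∈-map⁺ proj₁ a∈R))))))

  tables : List Table
  tables = vectors (k * suc m) bools

  outcomes : List Outcome
  outcomes = vectors (suc m) tables

  count-Fails : ∀ R i l ω → Unique (map proj₁ R) →
    count tables (λ τ → fails? R i l τ ω) * 2 ^ length R ≡ length tables * (2 ^ length R ∸ 1)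
  count-Fails R i l ω unique =
    subst (λ p → count tables (λ τ → fails? R i l τ ω) * 2 ^ p ≡ length tables * (2 ^ p ∸ 1))
          (length-map _ R) (count-violating (constraints R (i , l) ω) positions-unique)
    where
    positions-unique : Unique (map proj₁ (constraints R (i , l) ω))
    positions-unique = subst Unique (trans (sym (map-∘ {g = index} R)) (map-∘ {g = proj₁} R))
                             (Unique-map⁺ index-injective unique)

  freeCount-≥ : ∀ R → suc m ≤ freeCount (blocked? R) + suc (length R)
  freeCount-≥ R = begin
    suc m                                        ≡⟨ length-allFin (suc m) ⟨
    length (allFin (suc m))                      ≡⟨ count-+-count-¬ (allFin (suc m)) (blocked? R) ⟨
    count (allFin (suc m)) (blocked? R) + free   ≤⟨ +-monoˡ-≤ free (count-∈-≤ (zero ∷ levels R)) ⟩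
    suc (length (levels R)) + free              ≡⟨ +-comm (suc (length (levels R))) free ⟩
    free + suc (length (levels R))              ≡⟨ cong (λ p → free + suc p) length-levels ⟩
    free + suc (length R)                        ∎
    where
    open ≤-Reasoning
    free : ℕ
    free = freeCount (blocked? R)
    length-levels : length (levels R) ≡ length R
    length-levels = trans (length-map level (map proj₁ R)) (length-map proj₁ R)

  count-Bad-unique : ∀ R i s → Unique (map proj₁ R) → s * 2 ^ length R + suc (length R) ≤ suc m →
    count outcomes (bad? R i) * 2 ^ s ≤ length outcomes
  count-Bad-unique R i s unique room = subst (count outcomes (bad? R i) * 2 ^ s ≤_) (sym (length-vectors (suc m) tables))
    (≤-rescale (count outcomes (bad? R i)) (length tables ^ suc m) (D ^ free) (pred D ^ free) (2 ^ s)
               {{m^n≢0 D free {{m^n≢0 2 p}}}}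
      (subst (λ x → x * D ^ free ≤ length tables ^ suc m * pred D ^ free) (sym bad≡) every-bound)
      decay)
    where
    p D free : ℕ
    p = length R
    D = 2 ^ p
    free = freeCount (blocked? R)
    bad≡ : count outcomes (bad? R i) ≡ count outcomes (everyFreeSlot? (blocked? R) (fails? R i))
    bad≡ = count-⇔ outcomes (bad? R i) (everyFreeSlot? (blocked? R) (fails? R i)) (λ ω → mk⇔ proj₂ (unique ,_))
    every-bound : count outcomes (everyFreeSlot? (blocked? R) (fails? R i)) * D ^ free ≤ length tables ^ suc m * pred D ^ free
    every-bound = count-EveryFreeSlot-≤ D (pred D) tables (blocked? R) (fails? R i) (Fails-local R i)
                                        (λ l ω _ → ≤-reflexive (count-Fails R i l ω unique))
    D≡ : suc (pred D) ≡ D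
    D≡ = suc-pred D {{m^n≢0 2 p}}
    decay : pred D ^ free * 2 ^ s ≤ D ^ free
    decay = subst (λ d → pred D ^ free * 2 ^ s ≤ d ^ free) D≡
      (^-decay (pred D) s free (subst (λ d → s * d ≤ free) (sym D≡)
        (+-cancelʳ-≤ (suc p) (s * D) free (≤-trans room (freeCount-≥ R)))))

  count-Bad : ∀ R i s → s * 2 ^ length R + suc (length R) ≤ suc m → count outcomes (bad? R i) * 2 ^ s ≤ length outcomes
  count-Bad R i s room = by-uniqueness (unique? (map proj₁ R))
    where
    by-uniqueness : Dec (Unique (map proj₁ R)) → count outcomes (bad? R i) * 2 ^ s ≤ length outcomes
    by-uniqueness (yes unique) = count-Bad-unique R i s unique room
    by-uniqueness (no ¬unique) =
      ≤-trans (≤-reflexive (cong (_* 2 ^ s) (∀¬⇒count≡0 outcomes (bad? R i) (λ _ → ¬unique ∘ proj₁)))) z≤n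

  vertices : List Vertex
  vertices = cartesianProduct (allFin k) (allFin (suc m))

  labelled : List (Vertex × Bool)
  labelled = cartesianProduct vertices bools

  ∈-labelled : ∀ x → x ∈ labelled
  ∈-labelled ((i , t) , b) = ∈-cartesianProduct⁺ (∈-cartesianProduct⁺ (∈-allFin i) (∈-allFin t)) (∈-bools b)

  length-labelled : length labelled ≡ k * suc m * 2
  length-labelled = begin
    length labelled                                  ≡⟨ length-cartesianProductWith _,_ vertices bools ⟩
    length vertices * 2
      ≡⟨ cong (_* 2) (length-cartesianProductWith _,_ (allFin k) (allFin (suc m))) ⟩
    length (allFin k) * length (allFin (suc m)) * 2
      ≡⟨ cong₂ (λ a b → a * b * 2) (length-allFin k) (length-allFin (suc m)) ⟩
    k * suc m * 2                                    ∎
    where open ≡-Reasoning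

  requests : ℕ → List (List (Vertex × Bool) × Fin k)
  requests n = cartesianProduct (listsShorterThan n labelled) (allFin k)

  length-requests : ∀ n → length (requests n) ≤ suc (k * suc m * 2) ^ n * k
  length-requests n = begin
    length (requests n)
      ≡⟨ length-cartesianProductWith _,_ (listsShorterThan n labelled) (allFin k) ⟩
    length (listsShorterThan n labelled) * length (allFin k)
      ≤⟨ *-mono-≤ (length-listsShorterThan n labelled) (≤-reflexive (length-allFin k)) ⟩
    suc (length labelled) ^ n * k
      ≡⟨ cong (λ L → suc L ^ n * k) length-labelled ⟩
    suc (k * suc m * 2) ^ n * k ∎
    where open ≤-Reasoning

  good-outcome : ∀ n s → (∀ p → p < n → s * 2 ^ p + suc p ≤ suc m) → suc (k * suc m * 2) ^ n * k < 2 ^ s →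
    ∃ λ ω → ∀ {R i} → (R , i) ∈ requests n → ¬ Bad R i ω
  good-outcome n s room few = Σ.map₂ (λ none {R} {i} → none {R , i})
    (union-bound {Ev = λ (R , i) → Bad R i} (λ (R , i) → bad? R i) (requests n) outcomes (2 ^ s)
                 outcomes≢[] (≤-<-trans (length-requests n) few) rare)
    where
    outcomes≢[] : 0 < length outcomes
    outcomes≢[] = subst (0 <_) (sym (trans (length-vectors (suc m) tables)
                                           (cong (_^ suc m) (length-vectors (k * suc m) bools))))
                        (m^n>0 (2 ^ (k * suc m)) {{m^n≢0 2 (k * suc m)}} (suc m))
    rare : ∀ {r} → r ∈ requests n → count outcomes (bad? (proj₁ r) (proj₂ r)) * 2 ^ s ≤ length outcomes
    rare {R , i} Ri∈ = count-Bad R i s (room (length R)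
      (∈-listsShorterThan⁻ n labelled (proj₁ (∈-cartesianProduct⁻ (listsShorterThan n labelled) (allFin k) Ri∈))))

  xor-cancel : ∀ x y → x xor (y xor x) ≡ y
  xor-cancel false y     = xor-identityʳ y
  xor-cancel true  false = refl
  xor-cancel true  true  = refl

  coin-satisfied : ∀ R v ω → Satisfies (lookup ω (level v)) (constraints R v ω) →
    ∀ {a b} → (a , b) ∈ R → coin ω a v ≡ b
  coin-satisfied R v ω sat {a} {b} ab∈R =
    trans (cong (bit ω a v xor_) (All.lookup (map⁻ sat) ab∈R)) (xor-cancel (bit ω a v) b)

  free-level : ∀ R i ω → Unique (map proj₁ R) → ¬ Bad R i ω →
    ∃ λ l → ¬ Blocked R l × (∀ {a b} → (a , b) ∈ R → coin ω a (i , l) ≡ b)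
  free-level R i ω unique ¬bad
    with l , ¬blocked , ¬fails ← ¬EveryFreeSlot⇒ (blocked? R) (fails? R i) {ω} (¬bad ∘ (unique ,_)) =
    l , ¬blocked , coin-satisfied R (i , l) ω (decidable-stable (satisfies? (constraints R (i , l) ω) (lookup ω l)) ¬fails)

  label : (A : List Vertex) → (Fin (length A) → Bool) → List (Vertex × Bool)
  label A f = tabulate (λ r → List.lookup A r , f r)

  map-proj₁-label : ∀ A f → map proj₁ (label A f) ≡ A
  map-proj₁-label A f = trans (map-tabulate _ proj₁) (tabulate-lookup A)

  common-neighbour : ∀ {n} (H0 : Graph (Fin k)) → WeaklySaturated n H0 → (A : List Vertex) → length A < n →
    ∃ λ i → ∀ r → E H0 (proj₁ (List.lookup A r)) i
  common-neighbour H0 weakly A len<n =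
    let rows<n = ≤-<-trans (≤-trans (length-deduplicate _≟_ (map proj₁ A)) (≤-reflexive (length-map proj₁ A))) len<n
        i , adjacent = weakly (deduplicate _≟_ (map proj₁ A)) (deduplicate-! _≟_ (map proj₁ A)) rows<n
    in i , λ r → adjacent _ (∈-deduplicate⁺ _≟_ (∈-map⁺ proj₁ (∈-lookup r)))

  saturated : ∀ {n} (H0 : Graph (Fin k)) → WeaklySaturated n H0 → ∀ ω →
    (∀ {R i} → (R , i) ∈ requests n → ¬ Bad R i ω) → Saturated n (Hm H0 m (coins ω))
  saturated {n} H0 weakly ω no-bad A unique len<n f
    with i , adjacent ← common-neighbour H0 weakly A len<n
    with l , ¬blocked , coin≡ ← free-level (label A f) i ω (subst Unique (sym (map-proj₁-label A f)) unique)
                                  (no-bad (∈-cartesianProduct⁺ (∈-listsShorterThan⁺ ∈-labelled (label A f)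
                                    (subst (_< n) (sym (length-tabulate _)) len<n)) (∈-allFin i)))
    = (i , l) , v∉A , λ r → mk⇔ (to r) (from r)
    where
    v∉A : (i , l) ∉ A
    v∉A v∈A = ¬blocked (there (subst (l ∈_) (cong (map level) (sym (map-proj₁-label A f))) (∈-map⁺ level v∈A)))
    to : ∀ r → HmE H0 m (coins ω) (List.lookup A r) (i , l) → f r ≡ true
    to r (inj₁ eq)                      = contradiction (subst (_∈ A) eq (∈-lookup r)) v∉A
    to r (inj₂ (inj₁ ((_ , l≡0) , _)))  = contradiction (here l≡0) ¬blocked
    to r (inj₂ (inj₂ (_ , _ , c≡true))) = trans (sym (coin≡ (∈-tabulate⁺ r))) c≡true
    from : ∀ r → f r ≡ true → HmE H0 m (coins ω) (List.lookup A r) (i , l)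
    from r fr = inj₂ (inj₂ (adjacent r , inj₂ (¬blocked ∘ here) , trans (coin≡ (∈-tabulate⁺ r)) fr))

  all-ones : Coins k m
  all-ones = (λ _ _ → true) , λ _ _ → refl

  EventX-all-ones : ∀ n (H0 : Graph (Fin k)) → EventX n H0 m all-ones
  EventX-all-ones n H0 p _ is i adjacent js = zero , edge
    where
    edge : ∀ r → HmE H0 m all-ones (is r , js r) (i , zero)
    edge r with js r ≟ zero
    ... | yes t≡0 = inj₂ (inj₁ ((t≡0 , refl) , adjacent r))
    ... | no  t≢0 = inj₂ (inj₂ (adjacent r , inj₁ t≢0 , refl))

lemma1 : (n k : ℕ) → n ≤ k → (H0 : Graph (Fin k)) → WeaklySaturated n H0 →
    ∃ λ (m : ℕ) →
      (∃ λ (cs : Coins k m) → Saturated n (Hm H0 m cs))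
      × (∃ λ (cs : Coins k m) → EventX n H0 m cs)
lemma1 n k _ H0 weakly = m , (coins ω , saturated H0 weakly ω (proj₂ good)) , (all-ones , EventX-all-ones n H0)
  where
  open Parameters n k
  open Model k m
  good : ∃ λ ω → ∀ {R i} → (R , i) ∈ requests n → ¬ Bad R i ω
  good = good-outcome n s m-large s-large
  ω : Outcome
  ω = proj₁ good
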